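{- Let $H$ be a bipartite graph with color classes $U=\{b_1,\dots,b_r\}$ and $V=V_1\cup\dots\cup V_k$, where the $V_i=\{p_{i,1},\dots,p_{i,\ell_i}\}$ are pairwise disjoint with $\ell_i>0$. Let $D$ be the digraph with vertex set $\{v_0,v_1,\dots,v_k\}\cup U\cup V$ (the $v_i$ new) and arcs: $v_{i-1}p_{i,j}$ and $p_{i,j}v_i$ for all $i\in\{1,\dots,k\}$, $j\in\{1,\dots,\ell_i\}$; an arc $b_\ell p_{i,j}$ for each edge $b_\ell p_{i,j}$ of $H$; and the arc $v_kv_0$. Then $D$ contains a dicycle $B$ and a cycle $C$ of $\mathrm{UG}(D)$ with $V(B)\cap V(C)=\emptyset$ if and only if there is a cycle in $H$ avoiding at least one vertex of $V_i$ for each $i\in\{1,\dots,k\}$.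
   Context: A dicycle is a directed cycle of $D$; $\mathrm{UG}(D)$ is the underlying undirected (multi)graph of $D$. -}

module Defs where

open import Data.Nat using (ℕ; zero; suc; _≤_; _<_)
open import Data.Nat.DivMod using (_mod_)
open import Data.Fin using (Fin; toℕ; inject₁; fromℕ) renaming (zero to fzero; suc to fsuc)
open import Data.Product using (Σ; ∃; _×_; _,_)
open import Data.Sum using (_⊎_; inj₁; inj₂)
open import Data.Empty using (⊥)
open import Relation.Binary.PropositionalEquality using (_≡_)
open import Function.Definitions using (Injective)

next : ∀ {n} → Fin n → Fin n
next {suc n} i = suc (toℕ i) mod suc n

record ClosedSeq (X : Set) (Adj : X → X → Set) (minLen : ℕ) : Set where
  field
    len    : ℕ
    long   : minLen ≤ len
    vert   : Fin len → X
    inj    : Injective _≡_ _≡_ vert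
    adj    : ∀ t → Adj (vert t) (vert (next t))

open ClosedSeq public

_∈C_ : ∀ {X Adj m} → X → ClosedSeq X Adj m → Set
x ∈C c = ∃ λ t → vert c t ≡ x

-- directed cycle of a digraph with arc relation Arc (length ≥ 1, loops allowed)
Dicycle : (X : Set) → (X → X → Set) → Set
Dicycle X Arc = ClosedSeq X Arc 1

-- cycle of an undirected (loopless, simple) graph with symmetric adjacency Adj
Cycle : (X : Set) → (X → X → Set) → Set
Cycle X Adj = ClosedSeq X Adj 3

UG : {X : Set} → (X → X → Set) → X → X → Set
UG Arc x y = Arc x y ⊎ Arc y x

-- The bipartite graph H: U = Fin r (vertices b_1..b_r),
-- V = ⋃ V_i, V_i = {p_{i,1..ℓ_i}}, represented by Σ (Fin k) (Fin ∘ ℓ).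
-- Edges given by E b i j  ("b p_{i,j} is an edge of H").

module Construction (r k : ℕ) (ℓ : Fin k → ℕ)
                    (E : Fin r → (i : Fin k) → Fin (ℓ i) → Set) where

  HV : Set
  HV = Fin r ⊎ Σ (Fin k) (λ i → Fin (ℓ i))

  HAdj : HV → HV → Set
  HAdj (inj₁ b) (inj₁ b') = ⊥
  HAdj (inj₁ b) (inj₂ (i , j)) = E b i j
  HAdj (inj₂ (i , j)) (inj₁ b) = E b i j
  HAdj (inj₂ _) (inj₂ _) = ⊥

  data DV : Set where
    vv : Fin (suc k) → DV
    bU : Fin r → DV
    pV : (i : Fin k) → Fin (ℓ i) → DV

  -- paper's index i ∈ {1..k} is (i : Fin k) here; v_{i-1} = vv (inject₁ i), v_i = vv (fsuc i)
  data Arc : DV → DV → Set where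
    in-arc  : ∀ i j → Arc (vv (inject₁ i)) (pV i j)
    out-arc : ∀ i j → Arc (pV i j) (vv (fsuc i))
    h-arc   : ∀ b i j → E b i j → Arc (bU b) (pV i j)
    back    : Arc (vv (fromℕ k)) (vv fzero)

-- Every dicycle of D must use the arc v_k v_0, and from v_{i-1} it can only continue
-- through some p_{i,j} to v_i; so a dicycle contains all of v_0, …, v_k and one vertex of
-- each V_i. A cycle of UG(D) disjoint from it therefore lives in U ∪ V, where UG(D)
-- induces exactly H, and avoids a vertex of each V_i. Conversely, if a cycle of H avoids
-- p_{i,j_i} for every i, it is disjoint from the dicycle v_0 p_{1,j_1} v_1 … p_{k,j_k} v_k.
module Submission where

open import Defs
open import Data.Nat using (ℕ; zero; suc; _<_; _%_; z≤n; s≤s; _≟_)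
open import Data.Nat.DivMod using (m<n⇒m%n≡m; n%n≡0)
open import Data.Fin using (Fin; toℕ; inject₁; fromℕ; fromℕ<; lower₁) renaming (zero to fzero; suc to fsuc)
open import Data.Fin.Properties
  using (toℕ-injective; toℕ-fromℕ; toℕ-fromℕ<; toℕ-inject₁; inject₁ℕ<; inject₁-injective;
         inject₁-lower₁; fromℕ≢inject₁; ≤fromℕ)
open import Data.Fin.Induction using (<-weakInduction; <-weakInduction-startingFrom)
open import Data.Product using (Σ; ∃; _×_; _,_; proj₁; proj₂)
open import Data.Sum using (_⊎_; inj₁; inj₂; [_,_])
import Data.Sum as Sum
open import Data.Empty using (⊥; ⊥-elim)
open import Relation.Nullary using (¬_; yes; no)
open import Relation.Binary.PropositionalEquality
  using (_≡_; refl; sym; trans; cong; subst₂; module ≡-Reasoning)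
open import Function.Definitions using (Injective)
open import Function.Base using (_∘_)
open import Function.Bundles using (_⇔_; mk⇔)

∈C-successor : ∀ {X Adj m} (c : ClosedSeq X Adj m) {x} → x ∈C c → ∃ λ y → Adj x y × y ∈C c
∈C-successor c (t , refl) = vert c (next t) , adj c t , next t , refl

ClosedSeq-nonempty : ∀ {X Adj m} (c : ClosedSeq X Adj (suc m)) → ∃ λ x → x ∈C c
ClosedSeq-nonempty c = vert c (fromℕ< (long c)) , fromℕ< (long c) , refl

next-inject₁ : ∀ {n} (t : Fin n) → next (inject₁ t) ≡ fsuc t
next-inject₁ {n} t = toℕ-injective (begin
  toℕ (next (inject₁ t))         ≡⟨ toℕ-fromℕ< _ ⟩
  suc (toℕ (inject₁ t)) % suc n  ≡⟨ m<n⇒m%n≡m (s≤s (inject₁ℕ< t)) ⟩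
  suc (toℕ (inject₁ t))          ≡⟨ cong suc (toℕ-inject₁ t) ⟩
  suc (toℕ t)                    ∎)
  where open ≡-Reasoning

next-fromℕ : ∀ n → next (fromℕ n) ≡ fzero
next-fromℕ n = toℕ-injective (begin
  toℕ (next (fromℕ n))         ≡⟨ toℕ-fromℕ< _ ⟩
  suc (toℕ (fromℕ n)) % suc n  ≡⟨ cong (λ m → suc m % suc n) (toℕ-fromℕ n) ⟩
  suc n % suc n                ≡⟨ n%n≡0 (suc n) ⟩
  0                            ∎)
  where open ≡-Reasoning

closedWalk : ∀ {X Adj} n (w : Fin (suc n) → X) → Injective _≡_ _≡_ w →
             (∀ t → Adj (w (inject₁ t)) (w (fsuc t))) → Adj (w (fromℕ n)) (w fzero) →
             Dicycle X Adj
closedWalk {Adj = Adj} n w w-inj step close = record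
  { len = suc n ; long = s≤s z≤n ; vert = w ; inj = w-inj ; adj = adj-next }
  where
  adj-next : ∀ t → Adj (w t) (w (next t))
  adj-next t with n ≟ toℕ t
  ... | yes n≡t rewrite sym (toℕ-injective (trans (toℕ-fromℕ n) n≡t)) | next-fromℕ n = close
  ... | no n≢t rewrite sym (inject₁-lower₁ t n≢t) | next-inject₁ (lower₁ t n≢t) = step _

module _ {X Y : Set} {A : X → X → Set} {B : Y → Y → Set} {m : ℕ}
         (f : Y → X) (f-inj : Injective _≡_ _≡_ f) where

  module _ (f-adj : ∀ {x y} → B x y → A (f x) (f y)) where

    mapClosedSeq : ClosedSeq Y B m → ClosedSeq X A m
    mapClosedSeq c = record
      { len = len c ; long = long c ; vert = λ t → f (vert c t)
      ; inj = λ e → inj c (f-inj e) ; adj = λ t → f-adj (adj c t) }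

    ∈C-map : ∀ (c : ClosedSeq Y B m) {x} → x ∈C mapClosedSeq c → ∃ λ y → y ∈C c × f y ≡ x
    ∈C-map c (t , refl) = vert c t , (t , refl) , refl

  module _ (f-adj : ∀ {x y} → A (f x) (f y) → B x y) (c : ClosedSeq X A m)
           (lift : ∀ t → ∃ λ y → f y ≡ vert c t) where

    liftClosedSeq : ClosedSeq Y B m
    liftClosedSeq = record
      { len = len c ; long = long c ; vert = λ t → proj₁ (lift t)
      ; inj = λ {s} {t} e → inj c (trans (sym (proj₂ (lift s))) (trans (cong f e) (proj₂ (lift t))))
      ; adj = λ t → f-adj (subst₂ A (sym (proj₂ (lift t))) (sym (proj₂ (lift (next t)))) (adj c t)) }

    ∈C-lift : ∀ {y} → y ∈C liftClosedSeq → f y ∈C c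
    ∈C-lift (t , refl) = t , sym (proj₂ (lift t))

double : ℕ → ℕ
double zero    = zero
double (suc k) = suc (suc (double k))

-- Position 2a is the a-th spine vertex inj₁ a, position 2i+1 the i-th middle vertex inj₂ i.
alternate : ∀ k → Fin (suc (double k)) → Fin (suc k) ⊎ Fin k
alternate _       fzero           = inj₁ fzero
alternate (suc k) (fsuc fzero)    = inj₂ fzero
alternate (suc k) (fsuc (fsuc t)) = Sum.map fsuc fsuc (alternate k t)

position : ∀ {k} → Fin (suc k) ⊎ Fin k → Fin (suc (double k))
position         (inj₁ fzero)    = fzero
position {suc k} (inj₁ (fsuc a)) = fsuc (fsuc (position (inj₁ a)))
position {suc k} (inj₂ fzero)    = fsuc fzero
position {suc k} (inj₂ (fsuc i)) = fsuc (fsuc (position (inj₂ i)))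

position-alternate : ∀ k t → position (alternate k t) ≡ t
position-alternate _       fzero           = refl
position-alternate (suc k) (fsuc fzero)    = refl
position-alternate (suc k) (fsuc (fsuc t)) with alternate k t | position-alternate k t
... | inj₁ a | e = cong (λ s → fsuc (fsuc s)) e
... | inj₂ i | e = cong (λ s → fsuc (fsuc s)) e

alternate-injective : ∀ k → Injective _≡_ _≡_ (alternate k)
alternate-injective k {s} {t} e = begin
  s                         ≡⟨ sym (position-alternate k s) ⟩
  position (alternate k s)  ≡⟨ cong position e ⟩
  position (alternate k t)  ≡⟨ position-alternate k t ⟩
  t                         ∎
  where open ≡-Reasoning

data Alternation {k : ℕ} : Fin (suc k) ⊎ Fin k → Fin (suc k) ⊎ Fin k → Set where
  enter : ∀ i → Alternation (inj₁ (inject₁ i)) (inj₂ i)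
  leave : ∀ i → Alternation (inj₂ i) (inj₁ (fsuc i))

alternate-step : ∀ k (t : Fin (double k)) → Alternation (alternate k (inject₁ t)) (alternate k (fsuc t))
alternate-step (suc k) fzero           = enter fzero
alternate-step (suc k) (fsuc fzero)    = leave fzero
alternate-step (suc k) (fsuc (fsuc t)) = shift (alternate-step k t)
  where
  shift : ∀ {x y} → Alternation x y → Alternation (Sum.map fsuc fsuc x) (Sum.map fsuc fsuc y)
  shift (enter i) = enter (fsuc i)
  shift (leave i) = leave (fsuc i)

alternate-last : ∀ k → alternate k (fromℕ (double k)) ≡ inj₁ (fromℕ k)
alternate-last zero    = refl
alternate-last (suc k) = cong (Sum.map fsuc fsuc) (alternate-last k)

module Properties (r k : ℕ) (ℓ : Fin k → ℕ)
                  (E : Fin r → (i : Fin k) → Fin (ℓ i) → Set) where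
  open Construction r k ℓ E

  embed : HV → DV
  embed (inj₁ b)       = bU b
  embed (inj₂ (i , j)) = pV i j

  embed-injective : Injective _≡_ _≡_ embed
  embed-injective {inj₁ _}       {inj₁ _}       refl = refl
  embed-injective {inj₂ (_ , _)} {inj₂ (_ , _)} refl = refl

  HAdj⇒UG : ∀ {x y} → HAdj x y → UG Arc (embed x) (embed y)
  HAdj⇒UG {inj₁ b}       {inj₂ (i , j)} e = inj₁ (h-arc b i j e)
  HAdj⇒UG {inj₂ (i , j)} {inj₁ b}       e = inj₂ (h-arc b i j e)

  UG⇒HAdj : ∀ {x y} → UG Arc (embed x) (embed y) → HAdj x y
  UG⇒HAdj {inj₁ _} {inj₂ _} (inj₁ (h-arc _ _ _ e)) = e
  UG⇒HAdj {inj₂ _} {inj₁ _} (inj₂ (h-arc _ _ _ e)) = e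
  UG⇒HAdj {inj₁ _} {inj₁ _} (inj₁ ())
  UG⇒HAdj {inj₁ _} {inj₁ _} (inj₂ ())
  UG⇒HAdj {inj₁ _} {inj₂ _} (inj₂ ())
  UG⇒HAdj {inj₂ _} {inj₁ _} (inj₁ ())
  UG⇒HAdj {inj₂ _} {inj₂ _} (inj₁ ())
  UG⇒HAdj {inj₂ _} {inj₂ _} (inj₂ ())

  spine-or-embedded : ∀ x → (∃ λ a → x ≡ vv a) ⊎ (∃ λ h → embed h ≡ x)
  spine-or-embedded (vv a)   = inj₁ (a , refl)
  spine-or-embedded (bU b)   = inj₂ (inj₁ b , refl)
  spine-or-embedded (pV i j) = inj₂ (inj₂ (i , j) , refl)

  module _ (B : Dicycle DV Arc) where

    spine-exit : ∀ {a} → vv a ∈C B →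
                 (∃ λ i → ∃ λ j → inject₁ i ≡ a × pV i j ∈C B) ⊎ (fromℕ k ≡ a × vv fzero ∈C B)
    spine-exit a∈B with ∈C-successor B a∈B
    ... | _ , in-arc i j , p∈B = inj₁ (i , j , refl , p∈B)
    ... | _ , back ,       v∈B = inj₂ (refl , v∈B)

    middle-exit : ∀ {i j} → pV i j ∈C B → vv (fsuc i) ∈C B
    middle-exit p∈B with ∈C-successor B p∈B
    ... | _ , out-arc _ _ , v∈B = v∈B

    spine-enters-layer : ∀ i → vv (inject₁ i) ∈C B → ∃ λ j → pV i j ∈C B
    spine-enters-layer i v∈B with spine-exit v∈B
    ... | inj₁ (_ , j , e , p∈B) with refl ← inject₁-injective e = j , p∈B
    ... | inj₂ (e , _) = ⊥-elim (fromℕ≢inject₁ e)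

    spine-advance : ∀ i → vv (inject₁ i) ∈C B → vv (fsuc i) ∈C B
    spine-advance i v∈B = middle-exit (proj₂ (spine-enters-layer i v∈B))

    spine-wrap : vv (fromℕ k) ∈C B → vv fzero ∈C B
    spine-wrap v∈B with spine-exit v∈B
    ... | inj₁ (_ , _ , e , _) = ⊥-elim (fromℕ≢inject₁ (sym e))
    ... | inj₂ (_ , v₀∈B)      = v₀∈B

    meets-spine : ∃ λ a → vv a ∈C B
    meets-spine with ClosedSeq-nonempty B
    ... | vv a   , x∈B = a , x∈B
    ... | pV i _ , x∈B = fsuc i , middle-exit x∈B
    ... | bU _   , x∈B with ∈C-successor B x∈B
    ...   | _ , h-arc _ i _ _ , p∈B = fsuc i , middle-exit p∈B

    contains-spine : ∀ a → vv a ∈C B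
    contains-spine = <-weakInduction InB v₀∈B spine-advance
      where
      InB : Fin (suc k) → Set
      InB a = vv a ∈C B
      v₀∈B : InB fzero
      v₀∈B = spine-wrap (<-weakInduction-startingFrom InB (proj₂ meets-spine) spine-advance
                                                       (≤fromℕ (proj₁ meets-spine)))

  tour : (∀ i → Fin (ℓ i)) → Fin (suc k) ⊎ Fin k → DV
  tour jf = [ vv , (λ i → pV i (jf i)) ]

  tour-injective : ∀ jf → Injective _≡_ _≡_ (tour jf)
  tour-injective jf {inj₁ _} {inj₁ _} refl = refl
  tour-injective jf {inj₂ _} {inj₂ _} refl = refl

  tour-arc : ∀ jf {x y} → Alternation x y → Arc (tour jf x) (tour jf y)
  tour-arc jf (enter i) = in-arc i (jf i)
  tour-arc jf (leave i) = out-arc i (jf i)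

  tour-close : ∀ jf → Arc (tour jf (alternate k (fromℕ (double k)))) (tour jf (inj₁ fzero))
  tour-close jf rewrite alternate-last k = back

  spineDicycle : (∀ i → Fin (ℓ i)) → Dicycle DV Arc
  spineDicycle jf = closedWalk (double k) (tour jf ∘ alternate k)
    (λ e → alternate-injective k (tour-injective jf e))
    (λ t → tour-arc jf (alternate-step k t)) (tour-close jf)

  tour-meets-embed : ∀ jf z h → tour jf z ≡ embed h → ∃ λ i → h ≡ inj₂ (i , jf i)
  tour-meets-embed jf (inj₂ i) (inj₂ (.i , .(jf i))) refl = i , refl
  tour-meets-embed jf (inj₁ _) (inj₁ _) ()
  tour-meets-embed jf (inj₁ _) (inj₂ _) ()
  tour-meets-embed jf (inj₂ _) (inj₁ _) ()

  ∈C-spineDicycle : ∀ jf {x} → x ∈C spineDicycle jf → ∃ λ z → tour jf z ≡ x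
  ∈C-spineDicycle jf (t , e) = alternate k t , e

  DisjointPair : Set
  DisjointPair = Σ (Dicycle DV Arc) λ B → Σ (Cycle DV (UG Arc)) λ C → ∀ x → x ∈C B → x ∈C C → ⊥

  AvoidingCycle : Set
  AvoidingCycle = Σ (Cycle HV HAdj) λ C → ∀ i → ∃ λ j → ¬ (inj₂ (i , j) ∈C C)

  disjoint⇒avoiding : DisjointPair → AvoidingCycle
  disjoint⇒avoiding (B , C , disjoint) = CH , avoids
    where
    off-spine : ∀ t → ∃ λ h → embed h ≡ vert C t
    off-spine t with spine-or-embedded (vert C t)
    ... | inj₁ (a , e) = ⊥-elim (disjoint (vv a) (contains-spine B a) (t , e))
    ... | inj₂ lifted  = lifted

    CH : Cycle HV HAdj
    CH = liftClosedSeq embed embed-injective UG⇒HAdj C off-spine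

    avoids : ∀ i → ∃ λ j → ¬ (inj₂ (i , j) ∈C CH)
    avoids i with spine-enters-layer B i (contains-spine B (inject₁ i))
    ... | j , p∈B = j , λ p∈CH →
      disjoint (pV i j) p∈B (∈C-lift embed embed-injective UG⇒HAdj C off-spine p∈CH)

  avoiding⇒disjoint : AvoidingCycle → DisjointPair
  avoiding⇒disjoint (C , avoids) = spineDicycle jf , C′ , disjoint
    where
    jf : ∀ i → Fin (ℓ i)
    jf i = proj₁ (avoids i)

    C′ : Cycle DV (UG Arc)
    C′ = mapClosedSeq embed embed-injective HAdj⇒UG C

    disjoint : ∀ x → x ∈C spineDicycle jf → x ∈C C′ → ⊥
    disjoint x x∈B x∈C′
      with ∈C-spineDicycle jf x∈B | ∈C-map {A = UG Arc} embed embed-injective HAdj⇒UG C x∈C′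
    ... | z , refl | h , h∈C , e with tour-meets-embed jf z h (sym e)
    ...   | i , refl = proj₂ (avoids i) h∈C

lemma6 : (r k : ℕ) (ℓ : Fin k → ℕ) (ℓpos : ∀ i → 0 < ℓ i)
         (E : Fin r → (i : Fin k) → Fin (ℓ i) → Set) →
         let open Construction r k ℓ E in
         (Σ (Dicycle DV Arc) λ B → Σ (Cycle DV (UG Arc)) λ C →
            ∀ x → x ∈C B → x ∈C C → ⊥)
         ⇔
         (Σ (Cycle HV HAdj) λ C → ∀ i → ∃ λ j → ¬ (inj₂ (i , j) ∈C C))
lemma6 r k ℓ _ E = mk⇔ disjoint⇒avoiding avoiding⇒disjoint
  where open Properties r k ℓ E
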